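{- Let $M$ be an $m\times n$ matrix over $\{ -1,0,1\}$ containing a row equal to $(-1)^n$ and a row of the form $1^r0^s(-1)^t$ for some non-negative integers $r,s,t$ with $r\neq0$ and $t\neq0$. Then $G_o(M)$ is not semi-transitive.
   Context: Rows of matrices are written as strings of length $n$; $x^r$ denotes the symbol $x$ repeated $r$ times. For an $m\times n$ matrix $M=[m_{ij}]$ over $\{ -1,0,1\}$, $G_o(M)$ is the directed graph on vertex set $\{1,\dots,n+m\}$ with edges $j\to i$ for all $1\le j<i\le n$, and for $1\le p\le m$, $1\le j\le n$: an edge $j\to n+p$ if $m_{pj}=1$, an edge $n+p\to j$ if $m_{pj}=-1$, no edge if $m_{pj}=0$; no edges among $n+1,\dots,n+m$. A directed graph is semi-transitive if it is acyclic and for every directed path $u_1\to\cdots\to u_t$, $t\ge2$, either there is no edge $u_1\to u_t$ or all edges $u_i\to u_j$ ($1\le i<j\le t$) exist. -}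

module Defs where

open import Data.Nat using (ℕ; zero; suc; _+_; _<_; _≤_)
open import Data.Fin using (Fin; toℕ)
open import Data.Sum using (_⊎_; inj₁; inj₂)
open import Data.Product using (Σ; ∃; _×_; _,_)
open import Data.Empty using (⊥)
open import Relation.Nullary using (¬_)
open import Relation.Binary.PropositionalEquality using (_≡_)

data Entry : Set where
  neg zer pos : Entry

-- an m × n matrix: M p j is the entry in row p, column j (0-indexed)
Matrix : ℕ → ℕ → Set
Matrix m n = Fin m → Fin n → Entry

Digraph : Set → Set₁
Digraph V = V → V → Set

-- G_o(M): vertices are Fin n ⊎ Fin m; inj₁ j stands for vertex j+1 (1 ≤ j+1 ≤ n),
-- inj₂ p stands for vertex n+p+1.
data Go {m n : ℕ} (M : Matrix m n) : Digraph (Fin n ⊎ Fin m) where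
  col→col : ∀ {j i : Fin n} → toℕ j < toℕ i → Go M (inj₁ j) (inj₁ i)
  col→row : ∀ {j : Fin n} {p : Fin m} → M p j ≡ pos → Go M (inj₁ j) (inj₂ p)
  row→col : ∀ {j : Fin n} {p : Fin m} → M p j ≡ neg → Go M (inj₂ p) (inj₁ j)

IsPath : {V : Set} → Digraph V → (t : ℕ) → (Fin t → V) → Set
IsPath {V} E t u =
  (∀ (i j : Fin t) → u i ≡ u j → i ≡ j) ×
  (∀ (i j : Fin t) → toℕ j ≡ suc (toℕ i) → E (u i) (u j))

Acyclic : {V : Set} → Digraph V → Set
Acyclic {V} E =
  (∀ v → ¬ E v v) ×
  (∀ (t : ℕ) (u : Fin (suc (suc t)) → V) → IsPath E (suc (suc t)) u →
     ¬ E (u (Data.Fin.fromℕ (suc t))) (u Data.Fin.zero))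

SemiTransitive : {V : Set} → Digraph V → Set
SemiTransitive {V} E =
  Acyclic E ×
  (∀ (t : ℕ) (u : Fin (suc (suc t)) → V) → IsPath E (suc (suc t)) u →
     E (u Data.Fin.zero) (u (Data.Fin.fromℕ (suc t))) →
     ∀ (i j : Fin (suc (suc t))) → toℕ i < toℕ j → E (u i) (u j))

AllNegRow : {m n : ℕ} → Matrix m n → Fin m → Set
AllNegRow {m} {n} M p = ∀ (j : Fin n) → M p j ≡ neg

BlockRow : {m n : ℕ} → Matrix m n → Fin m → ℕ → ℕ → ℕ → Set
BlockRow {m} {n} M p r s t =
  (r + s + t ≡ n) ×
  (∀ (j : Fin n) →
     (toℕ j < r → M p j ≡ pos) ×
     ((r ≤ toℕ j × toℕ j < r + s) → M p j ≡ zer) ×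
     (r + s ≤ toℕ j → M p j ≡ neg))

-- A row of -1's and a row of the form 1^r 0^s (-1)^t with r, t ≠ 0 produce, from a
-- column j in the 1-block and a column j' in the (-1)-block, the directed path
-- p → j → q → j' in G_o(M) together with the shortcut p → j'.  Semi-transitivity
-- would then force an edge p → q, but there are no edges between row vertices.
module Submission where

open import Defs
open import Data.Nat using (ℕ; suc; _+_; z≤n; s≤s; _<_)
open import Data.Nat.Properties using (≤-reflexive; ≤-<-trans; m<m+n; n≢0⇒n>0; m+n≡0⇒m≡0)
open import Data.Fin using (Fin; toℕ; fromℕ<)
open import Data.Fin.Patterns using (0F; 1F; 2F; 3F)
open import Data.Fin.Properties using (toℕ-fromℕ<)
open import Data.Sum using (inj₁; inj₂)
open import Data.Sum.Properties using (inj₁-injective)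
open import Data.Product using (∃; _×_; _,_; proj₁; proj₂)
open import Data.Empty using (⊥-elim)
open import Relation.Nullary using (¬_)
open import Relation.Binary.PropositionalEquality using (_≡_; _≢_; refl; sym; trans; cong; subst; module ≡-Reasoning)

path₄ : {V : Set} → V → V → V → V → Fin 4 → V
path₄ a b c d 0F = a
path₄ a b c d 1F = b
path₄ a b c d 2F = c
path₄ a b c d 3F = d

module _ {V : Set} {E : Digraph V} {a b c d : V} where

  path₄-isPath : a ≢ b → a ≢ c → a ≢ d → b ≢ c → b ≢ d → c ≢ d →
                 E a b → E b c → E c d → IsPath E 4 (path₄ a b c d)
  path₄-isPath a≢b a≢c a≢d b≢c b≢d c≢d ab bc cd = injective , consecutive
    where
    injective : ∀ i j → path₄ a b c d i ≡ path₄ a b c d j → i ≡ j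
    injective 0F 0F _ = refl
    injective 1F 1F _ = refl
    injective 2F 2F _ = refl
    injective 3F 3F _ = refl
    injective 0F 1F e = ⊥-elim (a≢b e)
    injective 0F 2F e = ⊥-elim (a≢c e)
    injective 0F 3F e = ⊥-elim (a≢d e)
    injective 1F 2F e = ⊥-elim (b≢c e)
    injective 1F 3F e = ⊥-elim (b≢d e)
    injective 2F 3F e = ⊥-elim (c≢d e)
    injective 1F 0F e = ⊥-elim (a≢b (sym e))
    injective 2F 0F e = ⊥-elim (a≢c (sym e))
    injective 3F 0F e = ⊥-elim (a≢d (sym e))
    injective 2F 1F e = ⊥-elim (b≢c (sym e))
    injective 3F 1F e = ⊥-elim (b≢d (sym e))
    injective 3F 2F e = ⊥-elim (c≢d (sym e))

    consecutive : ∀ i j → toℕ j ≡ suc (toℕ i) → E (path₄ a b c d i) (path₄ a b c d j)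
    consecutive 0F 1F _ = ab
    consecutive 1F 2F _ = bc
    consecutive 2F 3F _ = cd
    consecutive 0F 0F ()
    consecutive 0F 2F ()
    consecutive 0F 3F ()
    consecutive 1F 0F ()
    consecutive 1F 1F ()
    consecutive 1F 3F ()
    consecutive 2F 0F ()
    consecutive 2F 1F ()
    consecutive 2F 2F ()
    consecutive 3F 0F ()
    consecutive 3F 1F ()
    consecutive 3F 2F ()
    consecutive 3F 3F ()

  edge⇒≢ : Acyclic E → ∀ {x y} → E x y → x ≢ y
  edge⇒≢ (loopless , _) xy refl = loopless _ xy

  shortcut⇒¬semiTransitive : a ≢ c → b ≢ d → E a b → E b c → E c d → E a d → ¬ E a c →
                             ¬ SemiTransitive E
  shortcut⇒¬semiTransitive a≢c b≢d ab bc cd ad ¬ac (acyclic , closed) =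
    ¬ac (closed 2 (path₄ a b c d) path ad 0F 2F (s≤s z≤n))
    where
    path : IsPath E 4 (path₄ a b c d)
    path = path₄-isPath (edge⇒≢ acyclic ab) a≢c (edge⇒≢ acyclic ad) (edge⇒≢ acyclic bc) b≢d
                        (edge⇒≢ acyclic cd) ab bc cd

module _ {m n : ℕ} {M : Matrix m n} where

  Go-row↛row : ∀ {p q} → ¬ Go M (inj₂ p) (inj₂ q)
  Go-row↛row ()

  Go-¬semiTransitive : ∀ {p q j j′} → j ≢ j′ →
    M p j ≡ neg → M p j′ ≡ neg → M q j ≡ pos → M q j′ ≡ neg → ¬ SemiTransitive (Go M)
  Go-¬semiTransitive {p} {q} j≢j′ pj pj′ qj qj′ =
    shortcut⇒¬semiTransitive {E = Go M} p≢q (λ e → j≢j′ (inj₁-injective e))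
      (row→col pj) (col→row qj) (row→col qj′) (row→col pj′) Go-row↛row
    where
    p≢q : inj₂ {A = Fin n} p ≢ inj₂ q
    p≢q refl with () ← trans (sym pj) qj

corollary2p17 : (m n : ℕ) (M : Matrix m n) →
    (∃ λ (p : Fin m) → AllNegRow M p) →
    (∃ λ (q : Fin m) → ∃ λ (r : ℕ) → ∃ λ (s : ℕ) → ∃ λ (t : ℕ) →
       r ≢ 0 × t ≢ 0 × BlockRow M q r s t) →
    ¬ SemiTransitive (Go M)
corollary2p17 m n M (p , p-neg) (q , r , s , t , r≢0 , t≢0 , r+s+t≡n , q-block) =
  Go-¬semiTransitive j≢j′ (p-neg j) (p-neg j′) q-pos q-neg
  where
  r+s<n : r + s < n
  r+s<n = subst (r + s <_) r+s+t≡n (m<m+n (r + s) (n≢0⇒n>0 t≢0))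

  j j′ : Fin n
  j = fromℕ< (≤-<-trans z≤n r+s<n)
  j′ = fromℕ< r+s<n

  q-pos : M q j ≡ pos
  q-pos = proj₁ (q-block j) (subst (_< r) (sym (toℕ-fromℕ< _)) (n≢0⇒n>0 r≢0))

  q-neg : M q j′ ≡ neg
  q-neg = proj₂ (proj₂ (q-block j′)) (≤-reflexive (sym (toℕ-fromℕ< r+s<n)))

  j≢j′ : j ≢ j′
  j≢j′ j≡j′ = r≢0 (m+n≡0⇒m≡0 r (sym (begin
    0           ≡⟨ sym (toℕ-fromℕ< _) ⟩
    toℕ j       ≡⟨ cong toℕ j≡j′ ⟩
    toℕ j′      ≡⟨ toℕ-fromℕ< r+s<n ⟩
    r + s       ∎)))
    where open ≡-Reasoning
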